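{- Fix an integer $k\geq 2$ and let $(\mathcal{R}_n)_{n\geq 0}$ be the $k$-step Narayana numbers, defined by $\mathcal{R}_0=0$, $\mathcal{R}_i=1$ for $1\leq i\leq k-1$, and $\mathcal{R}_n=\mathcal{R}_{n-1}+\mathcal{R}_{n-k}$ for $n\geq k$. Then for every integer $n\geq 0$, \[ \left(k^k+(k-1)^{k-1}\right)\sum_{i=0}^{n}\mathcal{R}_i\mathcal{R}_{n-i} = k^{k-1}(n+k-2)\,\mathcal{R}_{n+k-1} - \sum_{j=0}^{k-2} k^{j}(k-1)^{k-2-j}\,(n+k+j-1)\,\mathcal{R}_{n+j}. \]
   Context: For $k=2$ the sequence $\mathcal{R}_n$ is the Fibonacci sequence. -}

module Defs where

open import Data.Nat using (ℕ; zero; suc; _+_; _*_; _∸_; _<_; _≤_; _<?_; s≤s; z≤n)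
open import Data.Nat.Properties using (≤-refl; m∸n≤m; ≤-trans)
open import Data.Nat.Induction using (<-rec)
open import Relation.Nullary using (yes; no)
import Data.Integer as ℤ
open ℤ using (ℤ)

-- Defined by well-founded recursion; for k ≥ 2 the recursive calls are on
-- smaller arguments. (For k < 2 the value is irrelevant; we define the
-- n-k call as n ∸ k which is only reached when k ≤ n, and guard k = 0.)
narayanaStep : (k : ℕ) → (n : ℕ) → ({m : ℕ} → m < n → ℕ) → ℕ
narayanaStep k zero rec = 0
narayanaStep k (suc n) rec with suc n <? k
... | yes _ = 1
narayanaStep zero (suc n) rec | no _ = 0
narayanaStep (suc k') (suc n) rec | no _ =
  rec {n} ≤-refl + rec {n ∸ k'} (s≤s (m∸n≤m n k'))

R : ℕ → ℕ → ℕ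
R k = <-rec (λ _ → ℕ) (narayanaStep k)

sumTo : ℕ → (ℕ → ℤ) → ℤ
sumTo zero f = f 0
sumTo (suc n) f = sumTo n f ℤ.+ f (suc n)

sumBelow : ℕ → (ℕ → ℤ) → ℤ
sumBelow zero f = ℤ.0ℤ
sumBelow (suc m) f = sumBelow m f ℤ.+ f m

-- Extend R by zero to ℤ and let Δ U n = U n - U (n - 1) - U (n - k). Then Δ R is the
-- indicator of n = 1, so the convolution C n = Σ R i R (n - i) satisfies Δ C n = R (n - 1).
-- The right-hand side T, read as a function of n ∈ ℤ, satisfies Δ T n = D R (n - 1) with
-- D = k^k + (k-1)^(k-1): a term (n + β - 1 + γ) R (n + β) only contributes γ Δ R (n + β)
-- plus shifted values of R, because its weight vanishes exactly where Δ R (n + β) does not,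
-- and with the given coefficients these contributions telescope. Both D C and T vanish for
-- n ≤ 1 - k, and a function is determined by its Δ and its values on n ≤ 1 - k.
module Submission where

open import Data.Nat using (ℕ; zero; suc; _≤_; _<_; _∸_; s≤s; z≤n; _<?_)
import Data.Nat as ℕ
import Data.Nat.Properties as ℕP
open import Data.Nat.Induction using (<-wellFounded; <-Rec)
open import Induction.WellFounded using (module FixPoint)
open import Data.Integer
  using (ℤ; +_; -[1+_]; 0ℤ; 1ℤ; -_; _+_; _*_; _-_; _^_; ∣_∣; +≤+; -≤+; _≟_)
  renaming (_≤_ to _≤ℤ_)
open import Data.Integer.Properties
  using (≤-trans; ≤-reflexive; +-monoˡ-≤; +-monoʳ-≤; neg-mono-≤; i-j≤i; +-identityˡ; +-identityʳ;
         +-inverseʳ; *-zeroʳ; *-identityʳ; *-assoc; +-injective; pos-+; pos-*; m-n≡m⊖n; ⊖-≥; ⊖-<; n⊖n≡0)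
open import Data.Integer.Tactic.RingSolver using (solve-∀)
open import Function using (_∘_)
open import Relation.Nullary using (yes; no; contradiction)
open import Relation.Binary.PropositionalEquality
open ≡-Reasoning
open import Defs

-- Narayana numbers

narayanaStep-cong : ∀ k n {IH IH′ : <-Rec (λ _ → ℕ) n} →
                    (∀ {m} m<n → IH {m} m<n ≡ IH′ m<n) →
                    narayanaStep k n IH ≡ narayanaStep k n IH′
narayanaStep-cong k zero eq = refl
narayanaStep-cong k (suc n) eq with suc n <? k
... | yes _ = refl
narayanaStep-cong zero     (suc n) eq | no _ = refl
narayanaStep-cong (suc k′) (suc n) eq | no _ =
  cong₂ ℕ._+_ (eq ℕP.≤-refl) (eq (s≤s (ℕP.m∸n≤m n k′)))

R-unfold : ∀ k n → R k n ≡ narayanaStep k n (λ {m} _ → R k m)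
R-unfold k n =
  FixPoint.unfold-wfRec <-wellFounded (λ _ → ℕ) (narayanaStep k) (narayanaStep-cong k) {n}

R-zero : ∀ k → R k 0 ≡ 0
R-zero k = R-unfold k 0

R-initial : ∀ k n → suc n < k → R k (suc n) ≡ 1
R-initial k n lt rewrite R-unfold k (suc n) with suc n <? k
... | yes _  = refl
... | no ¬lt = contradiction lt ¬lt

R-recurrence : ∀ K n → K ≤ n → R (suc K) (suc n) ≡ R (suc K) n ℕ.+ R (suc K) (n ∸ K)
R-recurrence K n K≤n rewrite R-unfold (suc K) (suc n) with suc n <? suc K
... | yes lt = contradiction (ℕP.≤-pred lt) (ℕP.<⇒≱ (s≤s K≤n))
... | no _   = refl

-- Finite sums

sumTo≡sumBelow : ∀ n f → sumTo n f ≡ sumBelow (suc n) f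
sumTo≡sumBelow zero    f = sym (+-identityˡ (f 0))
sumTo≡sumBelow (suc n) f = cong (_+ f (suc n)) (sumTo≡sumBelow n f)

sumBelow-cong : ∀ m {f g} → (∀ j → j < m → f j ≡ g j) → sumBelow m f ≡ sumBelow m g
sumBelow-cong zero    eq = refl
sumBelow-cong (suc m) eq =
  cong₂ _+_ (sumBelow-cong m (λ j j<m → eq j (ℕP.m<n⇒m<1+n j<m))) (eq m ℕP.≤-refl)

sumBelow-zero : ∀ m {f} → (∀ j → j < m → f j ≡ 0ℤ) → sumBelow m f ≡ 0ℤ
sumBelow-zero zero    eq = refl
sumBelow-zero (suc m) eq =
  cong₂ _+_ (sumBelow-zero m (λ j j<m → eq j (ℕP.m<n⇒m<1+n j<m))) (eq m ℕP.≤-refl)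

sumBelow-single : ∀ m i {f} → i < m → (∀ j → j ≢ i → f j ≡ 0ℤ) → sumBelow m f ≡ f i
sumBelow-single (suc m) i {f} i<1+m off with i ℕP.≟ m
... | yes refl = trans (cong (_+ f m) (sumBelow-zero m (λ j j<m → off j (λ { refl → ℕP.<-irrefl refl j<m }))))
                       (+-identityˡ (f m))
... | no i≢m   = trans (cong₂ _+_ (sumBelow-single m i (ℕP.≤∧≢⇒< (ℕP.≤-pred i<1+m) i≢m) off)
                                  (off m (i≢m ∘ sym)))
                       (+-identityʳ (f i))

sumBelow-− : ∀ m f g → sumBelow m (λ j → f j - g j) ≡ sumBelow m f - sumBelow m g
sumBelow-− zero    f g = refl
sumBelow-− (suc m) f g =
  trans (cong (_+ (f m - g m)) (sumBelow-− m f g))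
        (regroup (sumBelow m f) (sumBelow m g) (f m) (g m))
  where
    regroup : ∀ F G x y → (F - G) + (x - y) ≡ (F + x) - (G + y)
    regroup = solve-∀

sumBelow-telescope : ∀ m (φ : ℕ → ℤ) → sumBelow m (λ j → φ (suc j) - φ j) ≡ φ m - φ 0
sumBelow-telescope zero    φ = sym (+-inverseʳ (φ 0))
sumBelow-telescope (suc m) φ =
  trans (cong (_+ (φ (suc m) - φ m)) (sumBelow-telescope m φ)) (chain (φ (suc m)) (φ m) (φ 0))
  where
    chain : ∀ a b c → (b - c) + (a - b) ≡ a - c
    chain = solve-∀

+m-+n≡+[m∸n] : ∀ {m n} → n ≤ m → + m - + n ≡ + (m ∸ n)
+m-+n≡+[m∸n] {m} {n} n≤m = trans (m-n≡m⊖n m n) (⊖-≥ n≤m)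

≤0⇒≢1 : ∀ {m} → m ≤ℤ 0ℤ → m ≢ 1ℤ
≤0⇒≢1 (+≤+ ()) refl

-- The Narayana difference operator

module Difference (k : ℕ) where

  Δ : (ℤ → ℤ) → ℤ → ℤ
  Δ U n = U n - U (n - 1ℤ) - U (n - + k)

  Δ-*ˡ : ∀ c U n → Δ (λ m → c * U m) n ≡ c * Δ U n
  Δ-*ˡ c U n = distrib c (U n) (U (n - 1ℤ)) (U (n - + k))
    where
      distrib : ∀ c x y z → c * x - c * y - c * z ≡ c * (x - y - z)
      distrib = solve-∀

  Δ-− : ∀ U V n → Δ (λ m → U m - V m) n ≡ Δ U n - Δ V n
  Δ-− U V n = regroup (U n) (U (n - 1ℤ)) (U (n - + k)) (V n) (V (n - 1ℤ)) (V (n - + k))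
    where
      regroup : ∀ x y z x′ y′ z′ → (x - x′) - (y - y′) - (z - z′) ≡ (x - y - z) - (x′ - y′ - z′)
      regroup = solve-∀

  Δ-sumBelow : ∀ L (U : ℕ → ℤ → ℤ) n →
               Δ (λ m → sumBelow L (λ j → U j m)) n ≡ sumBelow L (λ j → Δ (U j) n)
  Δ-sumBelow L U n = sym (begin
    sumBelow L (λ j → Δ (U j) n)
      ≡⟨ sumBelow-− L (λ j → U j n - U j (n - 1ℤ)) (λ j → U j (n - + k)) ⟩
    sumBelow L (λ j → U j n - U j (n - 1ℤ)) - sumBelow L (λ j → U j (n - + k))
      ≡⟨ cong (_- sumBelow L (λ j → U j (n - + k))) (sumBelow-− L (λ j → U j n) (λ j → U j (n - 1ℤ))) ⟩
    Δ (λ m → sumBelow L (λ j → U j m)) n ∎)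

  Δ-shift : ∀ s U n → Δ (λ m → U (m + s)) n ≡ Δ U (n + s)
  Δ-shift s U n = cong₂ (λ y z → U (n + s) - U y - U z) (shift n 1ℤ s) (shift n (+ k) s)
    where
      shift : ∀ i j s → i - j + s ≡ i + s - j
      shift = solve-∀

  Δ-linear-weight : ∀ d U n →
                    Δ (λ m → (m + d) * U m) n ≡ (n + d) * Δ U n + U (n - 1ℤ) + + k * U (n - + k)
  Δ-linear-weight d U n = expand n d (+ k) (U n) (U (n - 1ℤ)) (U (n - + k))
    where
      expand : ∀ n d k x y z →
               (n + d) * x - (n - 1ℤ + d) * y - (n - k + d) * z ≡ (n + d) * (x - y - z) + y + k * z
      expand = solve-∀

  Δ-unique : 1 ≤ k → ∀ (U V : ℤ → ℤ) c N →
             (∀ n → n ≤ℤ c → U n ≡ V n) →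
             (∀ n → n ≤ℤ N → Δ U n ≡ Δ V n) →
             ∀ n → n ≤ℤ N → U n ≡ V n
  Δ-unique 1≤k U V c N initial step n = agree ∣ n - c ∣ n (within n)
    where
      recover : ∀ W n → W n ≡ Δ W n + W (n - 1ℤ) + W (n - + k)
      recover W n = rearrange (W n) (W (n - 1ℤ)) (W (n - + k))
        where
          rearrange : ∀ x y z → x ≡ (x - y - z) + y + z
          rearrange = solve-∀

      within : ∀ n → n ≤ℤ c + + ∣ n - c ∣
      within n = ≤-trans (≤-reflexive (split n c)) (+-monoʳ-≤ c (i≤+∣i∣ (n - c)))
        where
          split : ∀ n c → n ≡ c + (n - c)
          split = solve-∀
          i≤+∣i∣ : ∀ i → i ≤ℤ + ∣ i ∣
          i≤+∣i∣ (+ _)    = ≤-reflexive refl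
          i≤+∣i∣ -[1+ _ ] = -≤+

      agree : ∀ t n → n ≤ℤ c + + t → n ≤ℤ N → U n ≡ V n
      agree zero    n n≤c _   = initial n (≤-trans n≤c (≤-reflexive (+-identityʳ c)))
      agree (suc t) n n≤ n≤N = begin
        U n                                 ≡⟨ recover U n ⟩
        Δ U n + U (n - 1ℤ) + U (n - + k)    ≡⟨ cong₂ _+_ (cong₂ _+_ (step n n≤N) (agree t (n - 1ℤ) n-1≤ n-1≤N))
                                                         (agree t (n - + k) (≤-trans n-k≤n-1 n-1≤) (≤-trans n-k≤n-1 n-1≤N)) ⟩
        Δ V n + V (n - 1ℤ) + V (n - + k)    ≡⟨ recover V n ⟨
        V n                                 ∎
        where
          drop-one : ∀ c t → c + (1ℤ + t) - 1ℤ ≡ c + t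
          drop-one = solve-∀
          n-1≤ : n - 1ℤ ≤ℤ c + + t
          n-1≤ = ≤-trans (+-monoˡ-≤ (- 1ℤ) n≤) (≤-reflexive (drop-one c (+ t)))
          n-1≤N : n - 1ℤ ≤ℤ N
          n-1≤N = ≤-trans (i-j≤i n 1ℤ) n≤N
          n-k≤n-1 : n - + k ≤ℤ n - 1ℤ
          n-k≤n-1 = +-monoʳ-≤ n (neg-mono-≤ (+≤+ 1≤k))

-- The convolution identity for k = a + 2

module Convolution (a : ℕ) where

  k K : ℕ
  k = suc (suc a)
  K = suc a

  open Difference k

  Rℤ : ℤ → ℤ
  Rℤ (+ m)    = + R k m
  Rℤ -[1+ m ] = 0ℤ

  Rℤ-nonpos : ∀ {m} → m ≤ℤ 0ℤ → Rℤ m ≡ 0ℤ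
  Rℤ-nonpos { -[1+ _ ]} _          = refl
  Rℤ-nonpos {+ zero}    _          = cong +_ (R-zero k)
  Rℤ-nonpos {+ suc _}   (+≤+ ())

  ΔRℤ-one : Δ Rℤ 1ℤ ≡ 1ℤ
  ΔRℤ-one rewrite R-initial k 0 (s≤s (s≤s z≤n)) | R-zero k = refl

  ΔRℤ-≢1 : ∀ m → m ≢ 1ℤ → Δ Rℤ m ≡ 0ℤ
  ΔRℤ-≢1 -[1+ _ ]          _   = refl
  ΔRℤ-≢1 (+ zero)          _   rewrite R-zero k = refl
  ΔRℤ-≢1 (+ suc zero)      m≢1 = contradiction refl m≢1
  ΔRℤ-≢1 (+ suc (suc p))   _   with p ℕ.<? a
  ... | yes p<a
    rewrite R-initial k (suc p) (s≤s (s≤s p<a))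
          | R-initial k p (s≤s (ℕP.m<n⇒m<1+n p<a))
          | trans (m-n≡m⊖n (suc (suc p)) k) (⊖-< (s≤s (s≤s p<a)))
          | Rℤ-nonpos (neg-mono-≤ (+≤+ (z≤n {a ∸ p})))
    = refl
  ... | no p≮a
    rewrite R-recurrence K (suc p) (s≤s (ℕP.≮⇒≥ p≮a))
          | trans (m-n≡m⊖n (suc (suc p)) k) (⊖-≥ (s≤s (s≤s (ℕP.≮⇒≥ p≮a))))
          | pos-+ (R k (suc p)) (R k (p ∸ a))
    = cancel (+ R k (suc p)) (+ R k (p ∸ a))
    where
      cancel : ∀ x y → x + y - x - y ≡ 0ℤ
      cancel = solve-∀

  [m-1]ΔRℤ≡0 : ∀ m → (m - 1ℤ) * Δ Rℤ m ≡ 0ℤ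
  [m-1]ΔRℤ≡0 m with m ≟ 1ℤ
  ... | yes refl = refl
  ... | no m≢1   = trans (cong ((m - 1ℤ) *_) (ΔRℤ-≢1 m m≢1)) (*-zeroʳ (m - 1ℤ))

  -- truncating at i ≤ L keeps the sum finite; for n ≤ L it is the whole convolution
  conv : ℕ → ℤ → ℤ
  conv L n = sumBelow (suc L) (λ i → Rℤ (+ i) * Rℤ (n - + i))

  conv-nonpos : ∀ L n → n ≤ℤ 0ℤ → conv L n ≡ 0ℤ
  conv-nonpos L n n≤0 = sumBelow-zero (suc L) λ i _ →
    trans (cong (Rℤ (+ i) *_) (Rℤ-nonpos (≤-trans (i-j≤i n (+ i)) n≤0))) (*-zeroʳ (Rℤ (+ i)))

  sample-nonpos : ∀ L n → n ≤ℤ 0ℤ → sumBelow (suc L) (λ i → Rℤ (+ i) * Δ Rℤ (n - + i)) ≡ Rℤ (n - 1ℤ)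
  sample-nonpos L n n≤0 = trans
    (sumBelow-zero (suc L) λ i _ →
      trans (cong (Rℤ (+ i) *_) (ΔRℤ-≢1 _ (≤0⇒≢1 (≤-trans (i-j≤i n (+ i)) n≤0)))) (*-zeroʳ (Rℤ (+ i))))
    (sym (Rℤ-nonpos (≤-trans (i-j≤i n 1ℤ) n≤0)))

  sample-ΔRℤ : ∀ L n → n ≤ℤ + L → sumBelow (suc L) (λ i → Rℤ (+ i) * Δ Rℤ (n - + i)) ≡ Rℤ (n - 1ℤ)
  sample-ΔRℤ L (+ suc m) (+≤+ m<L) = begin
    sumBelow (suc L) (λ i → Rℤ (+ i) * Δ Rℤ (+ suc m - + i))
      ≡⟨ sumBelow-single (suc L) m (ℕP.m<n⇒m<1+n m<L) off ⟩
    Rℤ (+ m) * Δ Rℤ (+ suc m - + m)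
      ≡⟨ cong (λ x → Rℤ (+ m) * Δ Rℤ x) (cancel (+ m)) ⟩
    Rℤ (+ m) * Δ Rℤ 1ℤ
      ≡⟨ trans (cong (Rℤ (+ m) *_) ΔRℤ-one) (*-identityʳ (Rℤ (+ m))) ⟩
    Rℤ (+ m) ∎
    where
      cancel : ∀ i → 1ℤ + i - i ≡ 1ℤ
      cancel = solve-∀
      split : ∀ i j → i ≡ (i - j) + j
      split = solve-∀
      1+m-i≢1 : ∀ i → i ≢ m → + suc m - + i ≢ 1ℤ
      1+m-i≢1 i i≢m eq = i≢m (sym (ℕP.suc-injective (+-injective (trans (split (+ suc m) (+ i)) (cong (_+ + i) eq)))))
      off : ∀ i → i ≢ m → Rℤ (+ i) * Δ Rℤ (+ suc m - + i) ≡ 0ℤ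
      off i i≢m = trans (cong (Rℤ (+ i) *_) (ΔRℤ-≢1 (+ suc m - + i) (1+m-i≢1 i i≢m))) (*-zeroʳ (Rℤ (+ i)))
  sample-ΔRℤ L (+ zero)   _ = sample-nonpos L (+ zero) (≤-reflexive refl)
  sample-ΔRℤ L -[1+ p ]   _ = sample-nonpos L -[1+ p ] -≤+

  Δ-conv : ∀ L n → n ≤ℤ + L → Δ (conv L) n ≡ Rℤ (n - 1ℤ)
  Δ-conv L n n≤L = begin
    Δ (conv L) n
      ≡⟨ Δ-sumBelow (suc L) (λ i m → Rℤ (+ i) * Rℤ (m - + i)) n ⟩
    sumBelow (suc L) (λ i → Δ (λ m → Rℤ (+ i) * Rℤ (m - + i)) n)
      ≡⟨ sumBelow-cong (suc L) (λ i _ →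
           trans (Δ-*ˡ (Rℤ (+ i)) (λ m → Rℤ (m - + i)) n) (cong (Rℤ (+ i) *_) (Δ-shift (- + i) Rℤ n))) ⟩
    sumBelow (suc L) (λ i → Rℤ (+ i) * Δ Rℤ (n - + i))
      ≡⟨ sample-ΔRℤ L n n≤L ⟩
    Rℤ (n - 1ℤ) ∎

  weighted : ℤ → ℤ → ℤ → ℤ
  weighted γ β m = (m + (β - 1ℤ + γ)) * Rℤ (m + β)

  Δ-weighted : ∀ γ β n → Δ (weighted γ β) n ≡
               γ * Rℤ (n + β) - (γ - 1ℤ) * Rℤ (n + β - 1ℤ) + (+ k - γ) * Rℤ (n + β - + k)
  Δ-weighted γ β n = begin
    Δ (weighted γ β) n
      ≡⟨ Δ-linear-weight (β - 1ℤ + γ) (λ m → Rℤ (m + β)) n ⟩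
    (n + (β - 1ℤ + γ)) * Δ (λ m → Rℤ (m + β)) n + Rℤ (n - 1ℤ + β) + + k * Rℤ (n - + k + β)
      ≡⟨ cong (λ u → (n + (β - 1ℤ + γ)) * u + Rℤ (n - 1ℤ + β) + + k * Rℤ (n - + k + β)) (Δ-shift β Rℤ n) ⟩
    (n + (β - 1ℤ + γ)) * Δ Rℤ (n + β) + Rℤ (n - 1ℤ + β) + + k * Rℤ (n - + k + β)
      ≡⟨ cong₂ (λ y′ z′ → (n + (β - 1ℤ + γ)) * Δ Rℤ (n + β) + Rℤ y′ + + k * Rℤ z′)
               (shift n 1ℤ β) (shift n (+ k) β) ⟩
    (n + (β - 1ℤ + γ)) * (x - y - z) + y + + k * z
      ≡⟨ split n β γ (+ k) x y z ⟩
    (n + β - 1ℤ) * Δ Rℤ (n + β) + (γ * x - (γ - 1ℤ) * y + (+ k - γ) * z)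
      ≡⟨ cong (_+ (γ * x - (γ - 1ℤ) * y + (+ k - γ) * z)) ([m-1]ΔRℤ≡0 (n + β)) ⟩
    0ℤ + (γ * x - (γ - 1ℤ) * y + (+ k - γ) * z)
      ≡⟨ +-identityˡ _ ⟩
    γ * x - (γ - 1ℤ) * y + (+ k - γ) * z ∎
    where
      x = Rℤ (n + β)
      y = Rℤ (n + β - 1ℤ)
      z = Rℤ (n + β - + k)
      shift : ∀ i j s → i - j + s ≡ i + s - j
      shift = solve-∀
      split : ∀ n β γ k x y z →
              (n + (β - 1ℤ + γ)) * (x - y - z) + y + k * z
                ≡ (n + β - 1ℤ) * (x - y - z) + (γ * x - (γ - 1ℤ) * y + (k - γ) * z)
      split = solve-∀

  D : ℤ
  D = (+ k) ^ k + (+ K) ^ K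

  coeff : ℕ → ℤ
  coeff j = (+ k) ^ j * (+ K) ^ (a ∸ j)

  T : ℤ → ℤ
  T n = (+ k) ^ K * weighted 0ℤ (+ K) n - sumBelow K (λ j → coeff j * weighted (+ k) (+ j) n)

  Φ : ℤ → ℕ → ℤ
  Φ n j = (+ k) ^ j * (+ K) ^ (K ∸ j) * Rℤ (n + + j - 1ℤ)

  coeff*Δweighted : ∀ n j → j < K → coeff j * Δ (weighted (+ k) (+ j)) n ≡ Φ n (suc j) - Φ n j
  coeff*Δweighted n j (s≤s j≤a) = begin
    coeff j * Δ (weighted (+ k) (+ j)) n
      ≡⟨ cong (coeff j *_) (Δ-weighted (+ k) (+ j) n) ⟩
    coeff j * (+ k * x - (+ k - 1ℤ) * y + (+ k - + k) * Rℤ (n + + j - + k))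
      ≡⟨ collect ((+ k) ^ j) ((+ K) ^ (a ∸ j)) (+ K) x y (Rℤ (n + + j - + k)) ⟩
    + k * (+ k) ^ j * (+ K) ^ (a ∸ j) * x - (+ k) ^ j * (+ K * (+ K) ^ (a ∸ j)) * y
      ≡⟨ cong₂ (λ x′ e → + k * (+ k) ^ j * (+ K) ^ (a ∸ j) * Rℤ x′ - (+ k) ^ j * (+ K) ^ e * y)
               (sym (drop-one n (+ j))) (sym (ℕP.+-∸-assoc 1 j≤a)) ⟩
    Φ n (suc j) - Φ n j ∎
    where
      x = Rℤ (n + + j)
      y = Rℤ (n + + j - 1ℤ)
      collect : ∀ Q E K x y z →
                Q * E * ((1ℤ + K) * x - ((1ℤ + K) - 1ℤ) * y + ((1ℤ + K) - (1ℤ + K)) * z)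
                  ≡ (1ℤ + K) * Q * E * x - Q * (K * E) * y
      collect = solve-∀
      drop-one : ∀ n j → n + (1ℤ + j) - 1ℤ ≡ n + j
      drop-one = solve-∀

  Δ-leading : ∀ n → Δ (weighted 0ℤ (+ K)) n ≡ Rℤ (n + + K - 1ℤ) + + k * Rℤ (n - 1ℤ)
  Δ-leading n = begin
    Δ (weighted 0ℤ (+ K)) n
      ≡⟨ Δ-weighted 0ℤ (+ K) n ⟩
    0ℤ * Rℤ (n + + K) - (0ℤ - 1ℤ) * y + (+ k - 0ℤ) * Rℤ (n + + K - + k)
      ≡⟨ cong (λ z → 0ℤ * Rℤ (n + + K) - (0ℤ - 1ℤ) * y + (+ k - 0ℤ) * Rℤ z) (back-one n (+ K)) ⟩
    0ℤ * Rℤ (n + + K) - (0ℤ - 1ℤ) * y + (+ k - 0ℤ) * Rℤ (n - 1ℤ)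
      ≡⟨ simplify (Rℤ (n + + K)) y (+ k) (Rℤ (n - 1ℤ)) ⟩
    y + + k * Rℤ (n - 1ℤ) ∎
    where
      y = Rℤ (n + + K - 1ℤ)
      back-one : ∀ n K → n + K - (1ℤ + K) ≡ n - 1ℤ
      back-one = solve-∀
      simplify : ∀ x y k z → 0ℤ * x - (0ℤ - 1ℤ) * y + (k - 0ℤ) * z ≡ y + k * z
      simplify = solve-∀

  Δ-tail : ∀ n → sumBelow K (λ j → coeff j * Δ (weighted (+ k) (+ j)) n)
                   ≡ (+ k) ^ K * Rℤ (n + + K - 1ℤ) - (+ K) ^ K * Rℤ (n - 1ℤ)
  Δ-tail n = begin
    sumBelow K (λ j → coeff j * Δ (weighted (+ k) (+ j)) n)
      ≡⟨ sumBelow-cong K (coeff*Δweighted n) ⟩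
    sumBelow K (λ j → Φ n (suc j) - Φ n j)
      ≡⟨ sumBelow-telescope K (Φ n) ⟩
    (+ k) ^ K * (+ K) ^ (K ∸ K) * y - 1ℤ * (+ K) ^ K * Rℤ (n + 0ℤ - 1ℤ)
      ≡⟨ cong₂ (λ e w → (+ k) ^ K * (+ K) ^ e * y - 1ℤ * (+ K) ^ K * Rℤ w)
               (ℕP.n∸n≡0 K) (cong (_- 1ℤ) (+-identityʳ n)) ⟩
    (+ k) ^ K * 1ℤ * y - 1ℤ * (+ K) ^ K * Rℤ (n - 1ℤ)
      ≡⟨ drop-units ((+ k) ^ K) ((+ K) ^ K) y (Rℤ (n - 1ℤ)) ⟩
    (+ k) ^ K * y - (+ K) ^ K * Rℤ (n - 1ℤ) ∎
    where
      y = Rℤ (n + + K - 1ℤ)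
      drop-units : ∀ P Q y z → P * 1ℤ * y - 1ℤ * Q * z ≡ P * y - Q * z
      drop-units = solve-∀

  ΔT : ∀ n → Δ T n ≡ D * Rℤ (n - 1ℤ)
  ΔT n = begin
    Δ T n
      ≡⟨ Δ-− (λ m → P * weighted 0ℤ (+ K) m) (λ m → sumBelow K (λ j → coeff j * weighted (+ k) (+ j) m)) n ⟩
    Δ (λ m → P * weighted 0ℤ (+ K) m) n - Δ (λ m → sumBelow K (λ j → coeff j * weighted (+ k) (+ j) m)) n
      ≡⟨ cong₂ _-_ (Δ-*ˡ P (weighted 0ℤ (+ K)) n)
                   (trans (Δ-sumBelow K (λ j m → coeff j * weighted (+ k) (+ j) m) n)
                          (sumBelow-cong K (λ j _ → Δ-*ˡ (coeff j) (weighted (+ k) (+ j)) n))) ⟩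
    P * Δ (weighted 0ℤ (+ K)) n - sumBelow K (λ j → coeff j * Δ (weighted (+ k) (+ j)) n)
      ≡⟨ cong₂ _-_ (cong (P *_) (Δ-leading n)) (Δ-tail n) ⟩
    P * (y + + k * z) - (P * y - (+ K) ^ K * z)
      ≡⟨ collect P (+ k) ((+ K) ^ K) y z ⟩
    D * z ∎
    where
      P = (+ k) ^ K
      y = Rℤ (n + + K - 1ℤ)
      z = Rℤ (n - 1ℤ)
      collect : ∀ P k Q y z → P * (y + k * z) - (P * y - Q * z) ≡ (k * P + Q) * z
      collect = solve-∀

  weighted-vanish : ∀ γ j n → j ≤ K → n ≤ℤ -[1+ a ] → weighted γ (+ j) n ≡ 0ℤ
  weighted-vanish γ j n j≤K n≤ = trans (cong ((n + (+ j - 1ℤ + γ)) *_) (Rℤ-nonpos n+j≤0)) (*-zeroʳ (n + (+ j - 1ℤ + γ)))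
    where
      n+j≤0 : n + + j ≤ℤ 0ℤ
      n+j≤0 = ≤-trans (+-monoˡ-≤ (+ j) n≤)
                (≤-trans (+-monoʳ-≤ -[1+ a ] (+≤+ j≤K)) (≤-reflexive (n⊖n≡0 K)))

  T-vanish : ∀ n → n ≤ℤ -[1+ a ] → T n ≡ 0ℤ
  T-vanish n n≤ = cong₂ _-_
    (trans (cong ((+ k) ^ K *_) (weighted-vanish 0ℤ K n ℕP.≤-refl n≤)) (*-zeroʳ ((+ k) ^ K)))
    (sumBelow-zero K λ j j<K →
      trans (cong (coeff j *_) (weighted-vanish (+ k) j n (ℕP.<⇒≤ j<K) n≤)) (*-zeroʳ (coeff j)))

  D*conv≡T : ∀ L n → n ≤ℤ + L → D * conv L n ≡ T n
  D*conv≡T L = Δ-unique (s≤s z≤n) (λ n → D * conv L n) T -[1+ a ] (+ L) initial step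
    where
      initial : ∀ n → n ≤ℤ -[1+ a ] → D * conv L n ≡ T n
      initial n n≤ = trans (cong (D *_) (conv-nonpos L n (≤-trans n≤ -≤+)))
                           (trans (*-zeroʳ D) (sym (T-vanish n n≤)))
      step : ∀ n → n ≤ℤ + L → Δ (λ m → D * conv L m) n ≡ Δ T n
      step n n≤L = begin
        Δ (λ m → D * conv L m) n  ≡⟨ Δ-*ˡ D (conv L) n ⟩
        D * Δ (conv L) n          ≡⟨ cong (D *_) (Δ-conv L n n≤L) ⟩
        D * Rℤ (n - 1ℤ)           ≡⟨ ΔT n ⟨
        Δ T n                     ∎

  sumTo≡conv : ∀ N → sumTo N (λ i → + (R k i ℕ.* R k (N ∸ i))) ≡ conv N (+ N)
  sumTo≡conv N = trans (sumTo≡sumBelow N _) (sumBelow-cong (suc N) λ i i<1+N →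
    trans (pos-* (R k i) (R k (N ∸ i))) (cong (λ m → Rℤ (+ i) * Rℤ m) (sym (+m-+n≡+[m∸n] (ℕP.≤-pred i<1+N)))))

  T≡rhs : ∀ N → T (+ N) ≡ (+ k) ^ K * + (N ℕ.+ k ∸ 2) * + R k (N ℕ.+ k ∸ 1)
                          - sumBelow K (λ j → coeff j * + (N ℕ.+ k ℕ.+ j ∸ 1) * + R k (N ℕ.+ j))
  T≡rhs N = cong₂ _-_ leading (sumBelow-cong K λ j _ → term j)
    where
      leading : (+ k) ^ K * weighted 0ℤ (+ K) (+ N) ≡ (+ k) ^ K * + (N ℕ.+ k ∸ 2) * + R k (N ℕ.+ k ∸ 1)
      leading = trans (sym (*-assoc ((+ k) ^ K) _ _)) (cong₂ (λ w i → (+ k) ^ K * w * + R k i)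
        (begin
           + N + (+ a + 0ℤ)  ≡⟨ cong (λ w → + N + w) (+-identityʳ (+ a)) ⟩
           + N + + a         ≡⟨ pos-+ N a ⟨
           + (N ℕ.+ a)       ≡⟨ cong +_ (ℕP.+-∸-assoc N {k} {2} (s≤s (s≤s z≤n))) ⟨
           + (N ℕ.+ k ∸ 2)   ∎)
        (sym (ℕP.+-∸-assoc N {k} {1} (s≤s z≤n))))
      term : ∀ j → coeff j * weighted (+ k) (+ j) (+ N) ≡ coeff j * + (N ℕ.+ k ℕ.+ j ∸ 1) * + R k (N ℕ.+ j)
      term j = trans (sym (*-assoc (coeff j) _ _)) (cong (λ w → coeff j * w * + R k (N ℕ.+ j))
        (begin
           + N + (+ j - 1ℤ + + k)       ≡⟨ rearrange (+ N) (+ k) (+ j) ⟩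
           + N + + k + + j - 1ℤ         ≡⟨ cong (λ w → w + + j - 1ℤ) (pos-+ N k) ⟨
           + (N ℕ.+ k) + + j - 1ℤ       ≡⟨ cong (_- 1ℤ) (pos-+ (N ℕ.+ k) j) ⟨
           + (N ℕ.+ k ℕ.+ j) - 1ℤ       ≡⟨ +m-+n≡+[m∸n] (ℕP.≤-trans (ℕP.≤-trans (s≤s z≤n) (ℕP.m≤n+m k N)) (ℕP.m≤m+n (N ℕ.+ k) j)) ⟩
           + (N ℕ.+ k ℕ.+ j ∸ 1)        ∎))
        where
          rearrange : ∀ n k j → n + (j - 1ℤ + k) ≡ n + k + j - 1ℤ
          rearrange = solve-∀

theorem4p1 : (k : ℕ) → 2 ≤ k → (n : ℕ) →
    ((+ k) ^ k + (+ (k ∸ 1)) ^ (k ∸ 1)) * sumTo n (λ i → + (R k i Data.Nat.* R k (n ∸ i)))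
      ≡ (+ k) ^ (k ∸ 1) * (+ (n Data.Nat.+ k ∸ 2)) * (+ R k (n Data.Nat.+ k ∸ 1))
        - sumBelow (k ∸ 1) (λ j → (+ k) ^ j * (+ (k ∸ 1)) ^ (k ∸ 2 ∸ j)
                                   * (+ (n Data.Nat.+ k Data.Nat.+ j ∸ 1)) * (+ R k (n Data.Nat.+ j)))
theorem4p1 (suc (suc a)) (s≤s (s≤s z≤n)) N = begin
  D * sumTo N (λ i → + (R k i ℕ.* R k (N ∸ i)))  ≡⟨ cong (D *_) (sumTo≡conv N) ⟩
  D * conv N (+ N)                               ≡⟨ D*conv≡T N (+ N) (≤-reflexive refl) ⟩
  T (+ N)                                        ≡⟨ T≡rhs N ⟩
  _                                              ∎
  where open Convolution a
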